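{- There exist a finite relational vocabulary $\sigma$ and a Boolean query $\mathfrak{J}\subseteq\mathfrak{F}_\sigma$ that is $\mathbb{O}$-invariant elementary on $\mathfrak{F}_\sigma$ but is not elementary on $\mathfrak{F}_\sigma$ (i.e. there is no first-order $\sigma$-sentence $\psi$ with $\mathfrak{J}=\{\mathcal{A}\in\mathfrak{F}_\sigma:\mathcal{A}\models\psi\}$).
   Context: $\mathfrak{F}_\sigma$ is the class of finite $\sigma$-structures. Gaifman graph $\mathcal{G}(\mathcal{A})$: vertices are the elements of $\mathcal{A}$; distinct $a,a'$ are adjacent iff they occur together in some tuple of some relation of $\mathcal{A}$; neighbors of $a$ are the vertices adjacent to $a$. A local order on $\mathcal{A}$ is a ternary relation $\preceq$ such that $\preceq(a,b,c)$ implies $b,c$ are neighbors of $a$, and for each fixed $a$, $\{(b,c):\preceq(a,b,c)\}$ is a linear order on the neighbors of $a$. A first-order sentence $\theta$ in vocabulary $\sigma\cup\{\preceq\}$ is $\mathbb{O}$-invariant on $\mathfrak{F}_\sigma$ if for every $\mathcal{A}\in\mathfrak{F}_\sigma$ either all expansions $(\mathcal{A},\preceq)$ by a local order satisfy $\theta$ or none does; $\mathfrak{J}$ is $\mathbb{O}$-invariant elementary on $\mathfrak{F}_\sigma$ if for some such $\theta$, for all $\mathcal{A}\in\mathfrak{F}_\sigma$, $\mathcal{A}\in\mathfrak{J}$ iff some expansion of $\mathcal{A}$ by a local order satisfies $\theta$. -}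

module Defs where

open import Data.Nat using (ℕ; zero; suc)
open import Data.Fin using (Fin; zero; suc)
open import Data.Vec using (Vec; []; _∷_; map)
open import Data.Vec.Membership.Propositional using (_∈_)
open import Data.Bool using (Bool; true)
open import Data.Product using (Σ; ∃; _×_; _,_)
open import Data.Sum using (_⊎_)
open import Data.Empty using (⊥)
open import Relation.Nullary using (¬_)
open import Relation.Binary.PropositionalEquality using (_≡_; _≢_)
open import Function.Bundles using (_⇔_)

record Vocabulary : Set where
  field
    nsym  : ℕ
    arity : Fin nsym → ℕ
open Vocabulary public

record Structure (σ : Vocabulary) : Set where
  field
    size : ℕ
    rel  : (R : Fin (nsym σ)) → Vec (Fin size) (arity σ R) → Bool
open Structure public

data Formula (σ : Vocabulary) : ℕ → Set where
  atom  : ∀ {m} (R : Fin (nsym σ)) → Vec (Fin m) (arity σ R) → Formula σ m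
  equal : ∀ {m} → Fin m → Fin m → Formula σ m
  neg   : ∀ {m} → Formula σ m → Formula σ m
  conj  : ∀ {m} → Formula σ m → Formula σ m → Formula σ m
  ex    : ∀ {m} → Formula σ (suc m) → Formula σ m

Sentence : Vocabulary → Set
Sentence σ = Formula σ 0

Sat : ∀ {σ m} (A : Structure σ) → Vec (Fin (size A)) m → Formula σ m → Set
Sat A ρ (atom R xs) = rel A R (map (λ x → Data.Vec.lookup ρ x) xs) ≡ true
Sat A ρ (equal x y) = Data.Vec.lookup ρ x ≡ Data.Vec.lookup ρ y
Sat A ρ (neg φ)     = ¬ Sat A ρ φ
Sat A ρ (conj φ ψ)  = Sat A ρ φ × Sat A ρ ψ
Sat A ρ (ex φ)      = Σ (Fin (size A)) λ a → Sat A (a ∷ ρ) φ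

_⊨_ : ∀ {σ} → Structure σ → Sentence σ → Set
A ⊨ φ = Sat A [] φ

-- The vocabulary σ ∪ {⪯}: symbol zero is the new ternary symbol ⪯.
_⁺ : Vocabulary → Vocabulary
σ ⁺ = record { nsym = suc (nsym σ) ; arity = ar }
  where
    ar : Fin (suc (nsym σ)) → ℕ
    ar zero    = 3
    ar (suc R) = arity σ R

Ternary : ∀ {σ} → Structure σ → Set
Ternary A = Fin (size A) → Fin (size A) → Fin (size A) → Bool

expand : ∀ {σ} (A : Structure σ) → Ternary A → Structure (σ ⁺)
expand {σ} A L = record { size = size A ; rel = r }
  where
    r : (R : Fin (nsym (σ ⁺))) → Vec (Fin (size A)) (arity (σ ⁺) R) → Bool
    r zero    (a ∷ b ∷ c ∷ []) = L a b c
    r (suc R) t                = rel A R t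

Adjacent : ∀ {σ} (A : Structure σ) → Fin (size A) → Fin (size A) → Set
Adjacent {σ} A a b =
  a ≢ b × Σ (Fin (nsym σ)) λ R → Σ (Vec (Fin (size A)) (arity σ R)) λ t →
    (rel A R t ≡ true) × (a ∈ t) × (b ∈ t)

IsLocalOrder : ∀ {σ} (A : Structure σ) → Ternary A → Set
IsLocalOrder A L =
  (∀ a b c → L a b c ≡ true → Adjacent A a b × Adjacent A a c)
  × (∀ a b → Adjacent A a b → L a b b ≡ true)
  × (∀ a b c → L a b c ≡ true → L a c b ≡ true → b ≡ c)
  × (∀ a b c d → L a b c ≡ true → L a c d ≡ true → L a b d ≡ true)
  × (∀ a b c → Adjacent A a b → Adjacent A a c → (L a b c ≡ true) ⊎ (L a c b ≡ true))

OInvariant : ∀ {σ} → Sentence (σ ⁺) → Set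
OInvariant {σ} θ = (A : Structure σ) (L L' : Ternary A) →
  IsLocalOrder A L → IsLocalOrder A L' → expand A L ⊨ θ → expand A L' ⊨ θ

Query : Vocabulary → Set₁
Query σ = Structure σ → Set

OInvariantElementary : ∀ {σ} → Query σ → Set
OInvariantElementary {σ} J = Σ (Sentence (σ ⁺)) λ θ →
  OInvariant θ ×
  ((A : Structure σ) → J A ⇔ (Σ (Ternary A) λ L → IsLocalOrder A L × (expand A L ⊨ θ)))

Elementary : ∀ {σ} → Query σ → Set
Elementary {σ} J = Σ (Sentence σ) λ ψ → (A : Structure σ) → J A ⇔ (A ⊨ ψ)

-- θ speaks about a binary relation ⊑ and a local order ⪯. It asks that some element lies
-- above no atom and that any x can be enlarged by any atom b (so every set of atoms is the set
-- of atoms below some element), that some u has all atoms as neighbours (so ⪯ at u is a linear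
-- order of the atoms), and that some s lies above exactly every other atom along this order,
-- starting with the first atom and missing the last. The last clause forces the number of atoms
-- to be even; conversely, if it is even, the atoms of odd rank in any local order are the atoms
-- below some s. So θ is order-invariant and defines "evenly many atoms", which on the powerset
-- 𝒫 n of an n-set means that n is even.
--
-- This is not first-order: a tuple of subsets of an n-set partitions the points by their
-- membership pattern, and in 𝒫 (2^(k+1)) versus 𝒫 (2^(k+1) + 1) Duplicator can keep
-- corresponding classes of equal size or both of size at least 2^r, with r rounds to go.

module Submission where

open import Defs
open import Data.Bool using (Bool; true; false; _∧_; _∨_; not; if_then_else_)
open import Data.Bool.Properties using (∧-zeroʳ; ∧-conicalˡ; ∧-conicalʳ; ¬-not; not-involutive) renaming (_≟_ to _≟ᵇ_)
open import Data.Empty using (⊥-elim)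
open import Data.Fin using (Fin; zero; suc; _↑ˡ_; _↑ʳ_; splitAt; _≟_)
open import Data.Fin.Properties using (splitAt-↑ˡ; splitAt-↑ʳ; splitAt⁻¹-↑ˡ; splitAt⁻¹-↑ʳ; all?; any?)
open import Data.Fin.Subset using (_∪_)
open import Data.List using ([]; _∷_; filter; allFin)
open import Data.List.Membership.Propositional using (_∈_)
open import Data.List.Membership.Propositional.Properties using (∈-filter⁺; ∈-filter⁻; ∈-allFin)
open import Data.List.Relation.Unary.Any using (here; there)
open import Data.Nat using (ℕ; zero; suc; _+_; _∸_; _≤_; _<_; z≤n; s≤s; _≤?_)
open import Data.Nat.Properties
  using (≤-refl; ≤-trans; ≤-reflexive; <⇒≤; ≰⇒>; <⇒≱; <-irrefl; +-assoc; +-comm; +-suc; +-mono-<; ∸-mono;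
         m≤m+n; m≤n+m; m+n∸m≡n; m+n∸n≡m; m∸n≤m; m∸[m∸n]≡n; suc-injective; +-commutativeSemigroup)
open import Algebra.Properties.CommutativeSemigroup +-commutativeSemigroup using (x∙yz≈y∙xz)
open import Data.Product using (Σ; _×_; _,_; proj₁; proj₂)
open import Data.Product.Function.Dependent.Propositional using (Σ-⇔)
open import Data.Product.Function.NonDependent.Propositional using (_×-⇔_)
open import Data.Sum using (_⊎_; inj₁; inj₂; [_,_]′; map₁; map₂) renaming (map to map-⊎)
open import Data.Vec using (Vec; []; _∷_; lookup; map; tabulate; replicate)
open import Data.Vec.Properties using (∷-injectiveʳ; tabulate∘lookup; tabulate-cong; lookup-map; lookup∘tabulate; ≡-dec)
open import Data.Vec.Relation.Unary.Any using () renaming (here to hereⱽ; there to thereⱽ)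
open import Function using (_∘_; id; case_of_)
open import Function.Bundles using (_⇔_; mk⇔; Equivalence)
open import Function.Construct.Composition using (_⇔-∘_)
open import Function.Construct.Identity using (⇔-id; ↠-id)
open import Function.Construct.Symmetry using (⇔-sym)
open import Function.Related.TypeIsomorphisms using (¬-cong-⇔)
open import Relation.Binary.PropositionalEquality hiding (J)
open import Relation.Nullary using (¬_; Dec; yes; no; does)
open import Relation.Nullary.Decidable
  using (dec-true; dec-false; does-⇔; ¬?; _×-dec_; _⊎-dec_; _→-dec_; decidable-stable)
import Data.Fin as Fin
import Data.Fin.Properties as Fin
import Relation.Nullary.Decidable as Dec

χ : Bool → ℕ
χ b = if b then 1 else 0

count : ∀ {n} → (Fin n → Bool) → ℕ
count {zero}  p = 0
count {suc n} p = χ (p zero) + count (p ∘ suc)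

count-cong : ∀ {n} {p q : Fin n → Bool} → (∀ i → p i ≡ q i) → count p ≡ count q
count-cong {zero}  eq = refl
count-cong {suc n} eq = cong₂ (λ b c → χ b + c) (eq zero) (count-cong (eq ∘ suc))

count-true : ∀ n → count {n} (λ _ → true) ≡ n
count-true zero    = refl
count-true (suc n) = cong suc (count-true n)

count-false : ∀ n → count {n} (λ _ → false) ≡ 0
count-false zero    = refl
count-false (suc n) = count-false n

count-split : ∀ {n} (p q : Fin n → Bool) →
  count p ≡ count (λ i → q i ∧ p i) + count (λ i → not (q i) ∧ p i)
count-split {zero}  p q = refl
count-split {suc n} p q with q zero | count-split (p ∘ suc) (q ∘ suc)
... | true  | ih = trans (cong (χ (p zero) +_) ih) (sym (+-assoc (χ (p zero)) _ _))
... | false | ih = trans (cong (χ (p zero) +_) ih) (x∙yz≈y∙xz (χ (p zero)) (count (λ i → q (suc i) ∧ p (suc i))) _)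

count-choose : ∀ {n} (p : Fin n → Bool) k → k ≤ count p →
  Σ (Fin n → Bool) λ q → count (λ i → q i ∧ p i) ≡ k
count-choose {zero}  p .0 z≤n = (λ _ → false) , refl
count-choose {suc n} p k k≤ with p zero
count-choose {suc n} p zero _ | true = (λ _ → false) , count-false n
count-choose {suc n} p (suc k) (s≤s k≤) | true with count-choose (p ∘ suc) k k≤
... | q , eq = (λ { zero → true ; (suc i) → q i }) , cong suc eq
count-choose {suc n} p k k≤ | false with count-choose (p ∘ suc) k k≤
... | q , eq = (λ { zero → false ; (suc i) → q i }) , eq

count-pos : ∀ {n} (p : Fin n → Bool) i → p i ≡ true → 0 < count p
count-pos p zero    pi rewrite pi = s≤s z≤n
count-pos p (suc i) pi = ≤-trans (count-pos (p ∘ suc) i pi) (m≤n+m _ _)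

count-witness : ∀ {n} (p : Fin n → Bool) → 0 < count p → Σ (Fin n) λ i → p i ≡ true
count-witness {suc n} p pos with p zero in eq
... | true  = zero , eq
... | false = let i , pi = count-witness (p ∘ suc) pos in suc i , pi

count-mono : ∀ {n} (p q : Fin n → Bool) → (∀ i → p i ≡ true → q i ≡ true) → count p ≤ count q
count-mono {zero}  p q p⇒q = z≤n
count-mono {suc n} p q p⇒q with p zero in eq
... | true rewrite p⇒q zero eq = s≤s (count-mono (p ∘ suc) (q ∘ suc) (p⇒q ∘ suc))
... | false = ≤-trans (count-mono (p ∘ suc) (q ∘ suc) (p⇒q ∘ suc)) (m≤n+m _ _)

count-strict : ∀ {n} (p q : Fin n → Bool) → (∀ i → p i ≡ true → q i ≡ true) →
  ∀ j → p j ≡ false → q j ≡ true → count p < count q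
count-strict p q p⇒q zero pj qj rewrite pj | qj = s≤s (count-mono (p ∘ suc) (q ∘ suc) (p⇒q ∘ suc))
count-strict p q p⇒q (suc j) pj qj with p zero in eq
... | true rewrite p⇒q zero eq = s≤s (count-strict (p ∘ suc) (q ∘ suc) (p⇒q ∘ suc) j pj qj)
... | false = ≤-trans (count-strict (p ∘ suc) (q ∘ suc) (p⇒q ∘ suc) j pj qj) (m≤n+m _ _)

count-insert : ∀ {n} (p q : Fin n → Bool) j → (∀ i → i ≢ j → p i ≡ q i) →
  p j ≡ false → q j ≡ true → count q ≡ suc (count p)
count-insert p q zero p≡q pj qj rewrite pj | qj =
  cong suc (count-cong (λ i → sym (p≡q (suc i) λ ())))
count-insert p q (suc j) p≡q pj qj rewrite p≡q zero (λ ()) =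
  trans (cong (χ (q zero) +_) (count-insert (p ∘ suc) (q ∘ suc) j (λ i i≢j → p≡q (suc i) (i≢j ∘ Fin.suc-injective)) pj qj))
        (+-suc (χ (q zero)) _)

count-++ : ∀ m n (p : Fin (m + n) → Bool) →
  count p ≡ count (λ i → p (i ↑ˡ n)) + count (λ i → p (m ↑ʳ i))
count-++ zero    n p = refl
count-++ (suc m) n p = trans (cong (χ (p zero) +_) (count-++ m n (p ∘ suc))) (sym (+-assoc (χ (p zero)) _ _))

argmax : ∀ {n} {P : Fin n → Set} → (∀ i → Dec (P i)) → (w : Fin n → ℕ) → Σ (Fin n) P →
  Σ (Fin n) λ j → P j × (∀ i → P i → w i ≤ w j)
argmax {suc n} P? w (i , pi) with any? (P? ∘ suc)
argmax {suc n} P? w (zero  , p0) | no none = zero , p0 , λ { zero _ → ≤-refl ; (suc i) pi → ⊥-elim (none (i , pi)) }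
argmax {suc n} P? w (suc i , pi) | no none = ⊥-elim (none (i , pi))
... | yes tail with argmax (P? ∘ suc) (w ∘ suc) tail | P? zero
...   | j , pj , max | no ¬p0 = suc j , pj , λ { zero p0 → ⊥-elim (¬p0 p0) ; (suc i) pi → max i pi }
...   | j , pj , max | yes p0 with w (suc j) ≤? w zero
...     | yes wj≤w0 = zero , p0 , λ { zero _ → ≤-refl ; (suc i) pi → ≤-trans (max i pi) wj≤w0 }
...     | no wj≰w0  = suc j , pj , λ { zero _ → <⇒≤ (≰⇒> wj≰w0) ; (suc i) pi → max i pi }

does-true : ∀ {P : Set} (P? : Dec P) → does P? ≡ true → P
does-true (yes p) _ = p

≟ᵇ-true : ∀ x → does (x ≟ᵇ true) ≡ x
≟ᵇ-true true  = refl
≟ᵇ-true false = refl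

≟ᵇ-false : ∀ x → does (x ≟ᵇ false) ≡ not x
≟ᵇ-false true  = refl
≟ᵇ-false false = refl

∧-cong-when : ∀ {x y} c → (c ≡ true → x ≡ y) → x ∧ c ≡ y ∧ c
∧-cong-when {x} {y} false _ = trans (∧-zeroʳ x) (sym (∧-zeroʳ y))
∧-cong-when true x≡y = cong (_∧ true) (x≡y refl)

⇔¬⇒≡not : ∀ {x y} → (x ≡ true ⇔ (¬ y ≡ true)) → y ≡ not x
⇔¬⇒≡not {true}  {true}  e = ⊥-elim (Equivalence.to e refl refl)
⇔¬⇒≡not {true}  {false} e = refl
⇔¬⇒≡not {false} {true}  e = refl
⇔¬⇒≡not {false} {false} e with Equivalence.from e (λ ())
... | ()

≡true⇔not≢true : ∀ x → x ≡ true ⇔ (¬ not x ≡ true)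
≡true⇔not≢true true  = mk⇔ (λ _ ()) (λ _ → refl)
≡true⇔not≢true false = mk⇔ (λ ()) (λ h → ⊥-elim (h refl))

odd : ℕ → Bool
odd zero    = false
odd (suc n) = not (odd n)

odd-double : ∀ x → odd (x + x) ≡ false
odd-double zero    = refl
odd-double (suc x) = trans (cong (not ∘ odd) (+-suc x x)) (trans (not-involutive _) (odd-double x))

-- Ranks of conjuncts are added rather than maximised; an upper bound is all that is needed.
qr : ∀ {V m} → Formula V m → ℕ
qr (atom R xs) = 0
qr (equal x y) = 0
qr (neg φ)     = qr φ
qr (conj φ ψ)  = qr φ + qr ψ
qr (ex φ)      = suc (qr φ)

sat? : ∀ {V m} (A : Structure V) (ρ : Vec (Fin (size A)) m) (φ : Formula V m) → Dec (Sat A ρ φ)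
sat? A ρ (atom R xs) = rel A R _ ≟ᵇ true
sat? A ρ (equal x y) = lookup ρ x ≟ lookup ρ y
sat? A ρ (neg φ)     = ¬? (sat? A ρ φ)
sat? A ρ (conj φ ψ)  = sat? A ρ φ ×-dec sat? A ρ ψ
sat? A ρ (ex φ)      = any? λ a → sat? A (a ∷ ρ) φ

-- Opaque so that Sat cannot unfold them: a goal Sat A ρ (all φ) ⇔ P then unifies with the
-- conclusions of the sat-… combinators below, which lets formula meanings be computed compositionally.
opaque
  all : ∀ {V m} → Formula V (suc m) → Formula V m
  all φ = neg (ex (neg φ))

  _⇒ᶠ_ _∨ᶠ_ _⇔ᶠ_ : ∀ {V m} → Formula V m → Formula V m → Formula V m
  φ ⇒ᶠ ψ = neg (conj φ (neg ψ))
  φ ∨ᶠ ψ = neg (conj (neg φ) (neg ψ))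
  φ ⇔ᶠ ψ = conj (φ ⇒ᶠ ψ) (ψ ⇒ᶠ φ)

infixr 6 _∨ᶠ_
infix  5 _⇔ᶠ_
infixr 4 _⇒ᶠ_

module _ {V : Vocabulary} (A : Structure V) {m} {ρ : Vec (Fin (size A)) m} where
  opaque
    unfolding all _⇒ᶠ_ _∨ᶠ_ _⇔ᶠ_

    sat-∀ : ∀ {φ} {P : Fin (size A) → Set} → (∀ a → Sat A (a ∷ ρ) φ ⇔ P a) → Sat A ρ (all φ) ⇔ (∀ a → P a)
    sat-∀ {φ} h = mk⇔
      (λ s a → Equivalence.to (h a) (decidable-stable (sat? A (a ∷ ρ) φ) λ ¬φa → s (a , ¬φa)))
      (λ p (a , ¬φa) → ¬φa (Equivalence.from (h a) (p a)))

    sat-⇒ : ∀ {φ ψ} {P Q : Set} → Sat A ρ φ ⇔ P → Sat A ρ ψ ⇔ Q → Sat A ρ (φ ⇒ᶠ ψ) ⇔ (P → Q)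
    sat-⇒ {ψ = ψ} hφ hψ = mk⇔
      (λ s p → Equivalence.to hψ (decidable-stable (sat? A ρ ψ) λ ¬ψ → s (Equivalence.from hφ p , ¬ψ)))
      (λ f (p , ¬q) → ¬q (Equivalence.from hψ (f (Equivalence.to hφ p))))

    sat-∨ : ∀ {φ ψ} {P Q : Set} → Sat A ρ φ ⇔ P → Sat A ρ ψ ⇔ Q → Sat A ρ (φ ∨ᶠ ψ) ⇔ (P ⊎ Q)
    sat-∨ {φ} {ψ} {P} {Q} hφ hψ = mk⇔ to
      λ { (inj₁ p) (¬φ , _) → ¬φ (Equivalence.from hφ p) ; (inj₂ q) (_ , ¬ψ) → ¬ψ (Equivalence.from hψ q) }
      where
        to : Sat A ρ (φ ∨ᶠ ψ) → P ⊎ Q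
        to s with sat? A ρ φ
        ... | yes p = inj₁ (Equivalence.to hφ p)
        ... | no ¬φ = inj₂ (Equivalence.to hψ (decidable-stable (sat? A ρ ψ) λ ¬ψ → s (¬φ , ¬ψ)))

    sat-⇔ : ∀ {φ ψ} {P Q : Set} → Sat A ρ φ ⇔ P → Sat A ρ ψ ⇔ Q → Sat A ρ (φ ⇔ᶠ ψ) ⇔ (P ⇔ Q)
    sat-⇔ hφ hψ = mk⇔
      (λ (s , s') → mk⇔ (Equivalence.to (sat-⇒ hφ hψ) s) (Equivalence.to (sat-⇒ hψ hφ) s'))
      (λ e → Equivalence.from (sat-⇒ hφ hψ) (Equivalence.to e) , Equivalence.from (sat-⇒ hψ hφ) (Equivalence.from e))

-- Local orders

module _ {V : Vocabulary} (A : Structure V) (adjacent? : ∀ a b → Dec (Adjacent A a b)) where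

  private
    Ordered : Fin (size A) → Fin (size A) → Fin (size A) → Set
    Ordered a b c = Adjacent A a b × Adjacent A a c × b Fin.≤ c

    ordered? : ∀ a b c → Dec (Ordered a b c)
    ordered? a b c = adjacent? a b ×-dec adjacent? a c ×-dec (b Fin.≤? c)

  adjacencyOrder : Ternary A
  adjacencyOrder a b c = does (ordered? a b c)

  adjacencyOrder-isLocalOrder : IsLocalOrder A adjacencyOrder
  adjacencyOrder-isLocalOrder =
    (λ a b c o → let ab , ac , _ = ordered a b c o in ab , ac) ,
    (λ a b ab → dec-true (ordered? a b b) (ab , ab , Fin.≤-refl)) ,
    (λ a b c o o' → Fin.≤-antisym (proj₂ (proj₂ (ordered a b c o))) (proj₂ (proj₂ (ordered a c b o')))) ,
    (λ a b c d o o' → let ab , _ , b≤c = ordered a b c o ; _ , ad , c≤d = ordered a c d o' in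
                      dec-true (ordered? a b d) (ab , ad , Fin.≤-trans b≤c c≤d)) ,
    (λ a b c ab ac → [ (λ b≤c → inj₁ (dec-true (ordered? a b c) (ab , ac , b≤c)))
                     , (λ c≤b → inj₂ (dec-true (ordered? a c b) (ac , ab , c≤b))) ]′ (Fin.≤-total b c))
    where
      ordered : ∀ a b c → adjacencyOrder a b c ≡ true → Ordered a b c
      ordered a b c = does-true (ordered? a b c)

-- Atoms of a binary relation

σ : Vocabulary
σ = record { nsym = 1 ; arity = λ _ → 2 }

module _ (A : Structure σ) where

  _⊑_ : Fin (size A) → Fin (size A) → Set
  a ⊑ b = rel A zero (a ∷ b ∷ []) ≡ true

  IsBottom : Fin (size A) → Set
  IsBottom b = ∀ c → b ⊑ c

  IsAtom : Fin (size A) → Set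
  IsAtom a = ¬ IsBottom a × (∀ b → b ⊑ a → b ≡ a ⊎ IsBottom b)

  HasAtomlessElement : Set
  HasAtomlessElement = Σ (Fin (size A)) λ e → ∀ a → IsAtom a → ¬ a ⊑ e

  HasAtomJoins : Set
  HasAtomJoins = ∀ x b → IsAtom b → Σ (Fin (size A)) λ y → ∀ a → IsAtom a → a ⊑ y ⇔ (a ⊑ x ⊎ a ≡ b)

  module _ (L : Ternary A) (u : Fin (size A)) where

    Covers : Set
    Covers = ∀ a → IsAtom a → L u a a ≡ true

    IsFirst IsLast : Fin (size A) → Set
    IsFirst a = ∀ b → IsAtom b → L u a b ≡ true
    IsLast  a = ∀ b → IsAtom b → L u b a ≡ true

    Precedes : Fin (size A) → Fin (size A) → Set
    Precedes a b = a ≢ b × L u a b ≡ true × (∀ c → IsAtom c → L u a c ≡ true → L u c b ≡ true → c ≡ a ⊎ c ≡ b)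

    Alternates : Fin (size A) → Set
    Alternates s = (∀ a → IsAtom a → IsFirst a → a ⊑ s)
                 × (∀ a → IsAtom a → IsLast a → ¬ a ⊑ s)
                 × (∀ a b → IsAtom a → IsAtom b → Precedes a b → a ⊑ s ⇔ (¬ b ⊑ s))

  HasAlternatingElement : Ternary A → Set
  HasAlternatingElement L = Σ (Fin (size A)) λ u → Covers L u × Σ (Fin (size A)) (Alternates L u)

module _ (A : Structure σ) where

  _⊑?_ : ∀ a b → Dec (_⊑_ A a b)
  a ⊑? b = rel A zero (a ∷ b ∷ []) ≟ᵇ true

  IsBottom? : ∀ b → Dec (IsBottom A b)
  IsBottom? b = all? (b ⊑?_)

  IsAtom? : ∀ a → Dec (IsAtom A a)
  IsAtom? a = ¬? (IsBottom? a) ×-dec all? λ b → (b ⊑? a) →-dec ((b ≟ a) ⊎-dec IsBottom? b)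

  atomCount : ℕ
  atomCount = count (does ∘ IsAtom?)

  list-representable : HasAtomlessElement A → HasAtomJoins A →
    ∀ xs → Σ (Fin (size A)) λ y → ∀ a → IsAtom A a → _⊑_ A a y ⇔ a ∈ xs
  list-representable (e , atomless) joins [] =
    e , λ a at → mk⇔ (λ a⊑e → ⊥-elim (atomless a at a⊑e)) λ ()
  list-representable atomless joins (b ∷ xs) with list-representable atomless joins xs | IsAtom? b
  ... | y , rep | no ¬atb = y , λ a at → mk⇔ (there ∘ Equivalence.to (rep a at))
    λ { (here refl) → ⊥-elim (¬atb at) ; (there a∈xs) → Equivalence.from (rep a at) a∈xs }
  ... | y , rep | yes atb =
    let y' , join = joins y b atb in
    y' , λ a at → mk⇔
      (λ a⊑y' → [ there ∘ Equivalence.to (rep a at) , here ]′ (Equivalence.to (join a at) a⊑y'))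
      λ { (here a≡b) → Equivalence.from (join a at) (inj₂ a≡b)
        ; (there a∈xs) → Equivalence.from (join a at) (inj₁ (Equivalence.from (rep a at) a∈xs)) }

  representable : HasAtomlessElement A → HasAtomJoins A →
    ∀ {P : Fin (size A) → Set} → (∀ a → Dec (P a)) → Σ (Fin (size A)) λ y → ∀ a → IsAtom A a → _⊑_ A a y ⇔ P a
  representable atomless joins P? =
    let y , rep = list-representable atomless joins (filter P? (allFin _)) in
    y , λ a at → mk⇔ (proj₂ ∘ ∈-filter⁻ P? {xs = allFin _} ∘ Equivalence.to (rep a at))
                     (Equivalence.from (rep a at) ∘ ∈-filter⁺ P? (∈-allFin a))

  adjacent⇔ : ∀ a b → Adjacent A a b ⇔ (a ≢ b × (_⊑_ A a b ⊎ _⊑_ A b a))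
  adjacent⇔ a b = mk⇔ to from
    where
      to : Adjacent A a b → a ≢ b × (_⊑_ A a b ⊎ _⊑_ A b a)
      to (a≢b , zero , _ ∷ _ ∷ [] , r , hereⱽ refl , hereⱽ refl)                 = ⊥-elim (a≢b refl)
      to (a≢b , zero , _ ∷ _ ∷ [] , r , hereⱽ refl , thereⱽ (hereⱽ refl))         = a≢b , inj₁ r
      to (a≢b , zero , _ ∷ _ ∷ [] , r , thereⱽ (hereⱽ refl) , hereⱽ refl)         = a≢b , inj₂ r
      to (a≢b , zero , _ ∷ _ ∷ [] , r , thereⱽ (hereⱽ refl) , thereⱽ (hereⱽ refl)) = ⊥-elim (a≢b refl)
      from : a ≢ b × (_⊑_ A a b ⊎ _⊑_ A b a) → Adjacent A a b
      from (a≢b , inj₁ r) = a≢b , zero , a ∷ b ∷ [] , r , hereⱽ refl , thereⱽ (hereⱽ refl)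
      from (a≢b , inj₂ r) = a≢b , zero , b ∷ a ∷ [] , r , thereⱽ (hereⱽ refl) , hereⱽ refl

  adjacent? : ∀ a b → Dec (Adjacent A a b)
  adjacent? a b = Dec.map (⇔-sym (adjacent⇔ a b)) (¬? (a ≟ b) ×-dec (a ⊑? b ⊎-dec b ⊑? a))

covers⇒adjacent : ∀ {A : Structure σ} {L u} → IsLocalOrder A L → Covers A L u → ∀ a → IsAtom A a → Adjacent A u a
covers⇒adjacent {u = u} lo cov a at = proj₁ (proj₁ lo u a a (cov a at))

adjacent⇒covers : ∀ {A : Structure σ} {L u} → IsLocalOrder A L → (∀ a → IsAtom A a → Adjacent A u a) → Covers A L u
adjacent⇒covers {u = u} lo adjacent a at = proj₁ (proj₂ lo) u a (adjacent a at)

module Ranks (A : Structure σ) (L : Ternary A) (lo : IsLocalOrder A L) (u : Fin (size A)) (cov : Covers A L u) where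

  private
    U = Fin (size A)

  _≼_ : U → U → Set
  a ≼ b = L u a b ≡ true

  ≼-antisym : ∀ {a b} → a ≼ b → b ≼ a → a ≡ b
  ≼-antisym = proj₁ (proj₂ (proj₂ lo)) u _ _

  ≼-trans : ∀ {a b c} → a ≼ b → b ≼ c → a ≼ c
  ≼-trans = proj₁ (proj₂ (proj₂ (proj₂ lo))) u _ _ _

  ≼-total : ∀ {a b} → IsAtom A a → IsAtom A b → a ≼ b ⊎ b ≼ a
  ≼-total {a} {b} ata atb =
    proj₂ (proj₂ (proj₂ (proj₂ lo))) u a b (covers⇒adjacent lo cov a ata) (covers⇒adjacent lo cov b atb)

  ≼-or-≺ : ∀ {a b} → IsAtom A a → IsAtom A b → a ≼ b ⊎ (b ≼ a × b ≢ a)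
  ≼-or-≺ {a} {b} ata atb with ≼-total ata atb | b ≟ a
  ... | inj₁ a≼b | _        = inj₁ a≼b
  ... | inj₂ _   | yes refl = inj₁ (cov a ata)
  ... | inj₂ b≼a | no b≢a   = inj₂ (b≼a , b≢a)

  Below : U → U → Set
  Below a c = IsAtom A c × c ≼ a

  below? : ∀ a c → Dec (Below a c)
  below? a c = IsAtom? A c ×-dec (L u c a ≟ᵇ true)

  rank : U → ℕ
  rank a = count (does ∘ below? a)

  rank-pos : ∀ {a} → IsAtom A a → 0 < rank a
  rank-pos {a} at = count-pos _ a (dec-true (below? a a) (at , cov a at))

  rank-mono-strict : ∀ {a b} → IsAtom A b → a ≼ b → a ≢ b → rank a < rank b
  rank-mono-strict {a} {b} atb a≼b a≢b = count-strict _ _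
    (λ c c-below-a → dec-true (below? b c) (let atc , c≼a = does-true (below? a c) c-below-a in atc , ≼-trans c≼a a≼b))
    b (dec-false (below? a b) λ (_ , b≼a) → a≢b (≼-antisym a≼b b≼a)) (dec-true (below? b b) (atb , cov b atb))

  rank-precedes : ∀ {a b} → IsAtom A a → IsAtom A b → Precedes A L u a b → rank b ≡ suc (rank a)
  rank-precedes {a} {b} ata atb (a≢b , a≼b , between) = count-insert _ _ b
    (λ c c≢b → does-⇔ (mk⇔ (λ (atc , c≼a) → atc , ≼-trans c≼a a≼b) (λ (atc , c≼b) → atc , below-a atc c≢b c≼b))
                      (below? a c) (below? b c))
    (dec-false (below? a b) λ (_ , b≼a) → a≢b (≼-antisym a≼b b≼a)) (dec-true (below? b b) (atb , cov b atb))
    where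
      below-a : ∀ {c} → IsAtom A c → c ≢ b → c ≼ b → c ≼ a
      below-a {c} atc c≢b c≼b with ≼-total atc ata
      ... | inj₁ c≼a = c≼a
      ... | inj₂ a≼c = [ (λ { refl → cov c atc }) , (λ c≡b → ⊥-elim (c≢b c≡b)) ]′ (between c atc a≼c c≼b)

  rank-first : ∀ {a} → IsAtom A a → IsFirst A L u a → rank a ≡ 1
  rank-first {a} at first = trans
    (count-insert (λ _ → false) _ a (λ c c≢a → sym (dec-false (below? a c) λ (atc , c≼a) → c≢a (≼-antisym c≼a (first c atc))))
      refl (dec-true (below? a a) (at , cov a at)))
    (cong suc (count-false (size A)))

  rank-last : ∀ {a} → IsLast A L u a → rank a ≡ atomCount A
  rank-last {a} last = count-cong λ c → does-⇔ (mk⇔ proj₁ λ atc → atc , last c atc) (below? a c) (IsAtom? A c)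

  maximal-atom : ∀ {P : U → Set} → (∀ c → Dec (P c)) → (∀ {c} → P c → IsAtom A c) → Σ U P →
    Σ U λ j → P j × (∀ c → P c → c ≼ j)
  maximal-atom P? P⇒atom witness =
    let j , pj , max = argmax P? rank witness in
    j , pj , λ c pc → [ id , (λ (j≼c , j≢c) → ⊥-elim (<⇒≱ (rank-mono-strict (P⇒atom pc) j≼c j≢c) (max c pc))) ]′
                        (≼-or-≺ (P⇒atom pc) (P⇒atom pj))

  StrictlyBelow : U → U → Set
  StrictlyBelow a c = Below a c × c ≢ a

  strictly-below? : ∀ a c → Dec (StrictlyBelow a c)
  strictly-below? a c = below? a c ×-dec ¬? (c ≟ a)

  first-or-preceded : ∀ {a} → IsAtom A a → IsFirst A L u a ⊎ Σ U λ j → IsAtom A j × Precedes A L u j a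
  first-or-preceded {a} ata with any? (strictly-below? a)
  ... | no none = inj₁ λ b atb → [ id , (λ (b≼a , b≢a) → ⊥-elim (none (b , (atb , b≼a) , b≢a))) ]′ (≼-or-≺ ata atb)
  ... | yes witness with maximal-atom (strictly-below? a) (proj₁ ∘ proj₁) witness
  ...   | j , ((atj , j≼a) , j≢a) , max = inj₂ (j , atj , j≢a , j≼a , between)
    where
      between : ∀ c → IsAtom A c → j ≼ c → c ≼ a → c ≡ j ⊎ c ≡ a
      between c atc j≼c c≼a with c ≟ a
      ... | yes c≡a = inj₂ c≡a
      ... | no c≢a  = inj₁ (≼-antisym (max c ((atc , c≼a) , c≢a)) j≼c)

  last-atom : 0 < atomCount A → Σ U λ m → IsAtom A m × IsLast A L u m
  last-atom pos = maximal-atom (IsAtom? A) id (let a , at = count-witness _ pos in a , does-true (IsAtom? A a) at)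

  module _ {s : U} (alt : Alternates A L u s) where

    membership-parity : ∀ k {a} → IsAtom A a → rank a ≡ k → rel A zero (a ∷ s ∷ []) ≡ odd k
    membership-parity zero    at rank≡0 = ⊥-elim (<-irrefl (sym rank≡0) (rank-pos at))
    membership-parity (suc k) {a} at rank≡1+k with first-or-preceded at
    ... | inj₁ first with trans (sym rank≡1+k) (rank-first at first)
    ...   | refl = proj₁ alt a at first
    membership-parity (suc k) {a} at rank≡1+k | inj₂ (j , atj , j⋖a) =
      trans (⇔¬⇒≡not (proj₂ (proj₂ alt) j a atj at j⋖a))
            (cong not (membership-parity k atj (suc-injective (trans (sym (rank-precedes atj at j⋖a)) rank≡1+k))))

    alternation⇒even : odd (atomCount A) ≡ false
    alternation⇒even with atomCount A in eq
    ... | zero  = refl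
    ... | suc t =
      let m , atm , last = last-atom (subst (0 <_) (sym eq) (s≤s z≤n)) in
      trans (sym (membership-parity (suc t) atm (trans (rank-last last) eq))) (¬-not (proj₁ (proj₂ alt) m atm last))

  even⇒alternation : HasAtomlessElement A → HasAtomJoins A → odd (atomCount A) ≡ false → Σ U (Alternates A L u)
  even⇒alternation atomless joins even = s , first , last , precedes
    where
      odd-ranks = representable A atomless joins (λ a → odd (rank a) ≟ᵇ true)
      s = proj₁ odd-ranks
      s⇔odd = proj₂ odd-ranks
      first : ∀ a → IsAtom A a → IsFirst A L u a → _⊑_ A a s
      first a at isFirst = Equivalence.from (s⇔odd a at) (cong odd (rank-first at isFirst))
      last : ∀ a → IsAtom A a → IsLast A L u a → ¬ _⊑_ A a s
      last a at isLast a⊑s =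
        case trans (sym even) (trans (cong odd (sym (rank-last isLast))) (Equivalence.to (s⇔odd a at) a⊑s)) of λ ()
      precedes : ∀ a b → IsAtom A a → IsAtom A b → Precedes A L u a b → _⊑_ A a s ⇔ (¬ _⊑_ A b s)
      precedes a b ata atb a⋖b = ¬-cong-⇔ b-odd ⇔-∘ (≡true⇔not≢true (odd (rank a)) ⇔-∘ s⇔odd a ata)
        where
          b-odd : not (odd (rank a)) ≡ true ⇔ _⊑_ A b s
          b-odd = subst (λ r → odd r ≡ true ⇔ _⊑_ A b s) (rank-precedes ata atb a⋖b) (⇔-sym (s⇔odd b atb))

-- The sentence θ

v0 : ∀ {m} → Fin (suc m)
v0 = zero

v1 : ∀ {m} → Fin (suc (suc m))
v1 = suc v0

v2 : ∀ {m} → Fin (suc (suc (suc m)))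
v2 = suc v1

v3 : ∀ {m} → Fin (suc (suc (suc (suc m))))
v3 = suc v2

_⊑ᶠ_ : ∀ {m} → Fin m → Fin m → Formula (σ ⁺) m
x ⊑ᶠ y = atom (suc zero) (x ∷ y ∷ [])

_⪯⟨_⟩_ : ∀ {m} → Fin m → Fin m → Fin m → Formula (σ ⁺) m
x ⪯⟨ u ⟩ y = atom zero (u ∷ x ∷ y ∷ [])

infix 7 _⊑ᶠ_ _⪯⟨_⟩_

isBottomᶠ : ∀ {m} → Fin m → Formula (σ ⁺) m
isBottomᶠ x = all (suc x ⊑ᶠ v0)

isAtomᶠ : ∀ {m} → Fin m → Formula (σ ⁺) m
isAtomᶠ x = conj (neg (isBottomᶠ x)) (all (v0 ⊑ᶠ suc x ⇒ᶠ equal v0 (suc x) ∨ᶠ isBottomᶠ v0))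

atomlessᶠ : Sentence (σ ⁺)
atomlessᶠ = ex (all (isAtomᶠ v0 ⇒ᶠ neg (v0 ⊑ᶠ v1)))

atomJoinsᶠ : Sentence (σ ⁺)
atomJoinsᶠ = all (all (isAtomᶠ v0 ⇒ᶠ ex (all (isAtomᶠ v0 ⇒ᶠ (v0 ⊑ᶠ v1 ⇔ᶠ v0 ⊑ᶠ v3 ∨ᶠ equal v0 v2)))))

coversᶠ : ∀ {m} → Fin m → Formula (σ ⁺) m
coversᶠ u = all (isAtomᶠ v0 ⇒ᶠ v0 ⪯⟨ suc u ⟩ v0)

isFirstᶠ isLastᶠ : ∀ {m} → Fin m → Fin m → Formula (σ ⁺) m
isFirstᶠ u x = all (isAtomᶠ v0 ⇒ᶠ suc x ⪯⟨ suc u ⟩ v0)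
isLastᶠ  u x = all (isAtomᶠ v0 ⇒ᶠ v0 ⪯⟨ suc u ⟩ suc x)

precedesᶠ : ∀ {m} → Fin m → Fin m → Fin m → Formula (σ ⁺) m
precedesᶠ u x y = conj (neg (equal x y)) (conj (x ⪯⟨ u ⟩ y)
  (all (isAtomᶠ v0 ⇒ᶠ suc x ⪯⟨ suc u ⟩ v0 ⇒ᶠ v0 ⪯⟨ suc u ⟩ suc y ⇒ᶠ equal v0 (suc x) ∨ᶠ equal v0 (suc y))))

alternatesᶠ : ∀ {m} → Fin m → Fin m → Formula (σ ⁺) m
alternatesᶠ u s = conj (all (isAtomᶠ v0 ⇒ᶠ isFirstᶠ (suc u) v0 ⇒ᶠ v0 ⊑ᶠ suc s))
  (conj (all (isAtomᶠ v0 ⇒ᶠ isLastᶠ (suc u) v0 ⇒ᶠ neg (v0 ⊑ᶠ suc s)))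
        (all (all (isAtomᶠ v1 ⇒ᶠ isAtomᶠ v0 ⇒ᶠ precedesᶠ (suc (suc u)) v1 v0 ⇒ᶠ
                   (v1 ⊑ᶠ suc (suc s) ⇔ᶠ neg (v0 ⊑ᶠ suc (suc s)))))))

θ : Sentence (σ ⁺)
θ = conj atomlessᶠ (conj atomJoinsᶠ (ex (conj (coversᶠ v0) (ex (alternatesᶠ v1 v0)))))

module _ (A : Structure σ) (L : Ternary A) where
  private
    E = expand A L

  sat-isBottom : ∀ {m} (ρ : Vec (Fin (size A)) m) x → Sat E ρ (isBottomᶠ x) ⇔ IsBottom A (lookup ρ x)
  sat-isBottom ρ x = sat-∀ E λ _ → ⇔-id _

  sat-isAtom : ∀ {m} (ρ : Vec (Fin (size A)) m) x → Sat E ρ (isAtomᶠ x) ⇔ IsAtom A (lookup ρ x)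
  sat-isAtom ρ x = ¬-cong-⇔ (sat-isBottom ρ x) ×-⇔
    sat-∀ E λ b → sat-⇒ E (⇔-id _) (sat-∨ E (⇔-id _) (sat-isBottom (b ∷ ρ) v0))

  sat-covers : ∀ {m} (ρ : Vec (Fin (size A)) m) u → Sat E ρ (coversᶠ u) ⇔ Covers A L (lookup ρ u)
  sat-covers ρ u = sat-∀ E λ a → sat-⇒ E (sat-isAtom (a ∷ ρ) v0) (⇔-id _)

  sat-isFirst : ∀ {m} (ρ : Vec (Fin (size A)) m) u x → Sat E ρ (isFirstᶠ u x) ⇔ IsFirst A L (lookup ρ u) (lookup ρ x)
  sat-isFirst ρ u x = sat-∀ E λ b → sat-⇒ E (sat-isAtom (b ∷ ρ) v0) (⇔-id _)

  sat-isLast : ∀ {m} (ρ : Vec (Fin (size A)) m) u x → Sat E ρ (isLastᶠ u x) ⇔ IsLast A L (lookup ρ u) (lookup ρ x)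
  sat-isLast ρ u x = sat-∀ E λ b → sat-⇒ E (sat-isAtom (b ∷ ρ) v0) (⇔-id _)

  sat-precedes : ∀ {m} (ρ : Vec (Fin (size A)) m) u x y →
    Sat E ρ (precedesᶠ u x y) ⇔ Precedes A L (lookup ρ u) (lookup ρ x) (lookup ρ y)
  sat-precedes ρ u x y = ⇔-id _ ×-⇔ ⇔-id _ ×-⇔
    sat-∀ E λ c → sat-⇒ E (sat-isAtom (c ∷ ρ) v0) (sat-⇒ E (⇔-id _) (sat-⇒ E (⇔-id _) (sat-∨ E (⇔-id _) (⇔-id _))))

  sat-alternates : ∀ {m} (ρ : Vec (Fin (size A)) m) u s →
    Sat E ρ (alternatesᶠ u s) ⇔ Alternates A L (lookup ρ u) (lookup ρ s)
  sat-alternates ρ u s =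
    (sat-∀ E λ a → sat-⇒ E (sat-isAtom (a ∷ ρ) v0) (sat-⇒ E (sat-isFirst (a ∷ ρ) (suc u) v0) (⇔-id _))) ×-⇔
    (sat-∀ E λ a → sat-⇒ E (sat-isAtom (a ∷ ρ) v0) (sat-⇒ E (sat-isLast (a ∷ ρ) (suc u) v0) (⇔-id _))) ×-⇔
    (sat-∀ E λ a → sat-∀ E λ b → sat-⇒ E (sat-isAtom (b ∷ a ∷ ρ) v1) (sat-⇒ E (sat-isAtom (b ∷ a ∷ ρ) v0)
      (sat-⇒ E (sat-precedes (b ∷ a ∷ ρ) (suc (suc u)) v1 v0) (sat-⇔ E (⇔-id _) (⇔-id _)))))

  sat-θ : E ⊨ θ ⇔ (HasAtomlessElement A × HasAtomJoins A × HasAlternatingElement A L)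
  sat-θ =
    (Σ-⇔ (↠-id _) λ {e} → sat-∀ E λ a → sat-⇒ E (sat-isAtom (a ∷ e ∷ []) v0) (⇔-id _)) ×-⇔
    (sat-∀ E λ x → sat-∀ E λ b → sat-⇒ E (sat-isAtom (b ∷ x ∷ []) v0) (Σ-⇔ (↠-id _) λ {y} →
      sat-∀ E λ a → sat-⇒ E (sat-isAtom (a ∷ y ∷ b ∷ x ∷ []) v0) (sat-⇔ E (⇔-id _) (sat-∨ E (⇔-id _) (⇔-id _))))) ×-⇔
    (Σ-⇔ (↠-id _) λ {u} → sat-covers (u ∷ []) v0 ×-⇔ (Σ-⇔ (↠-id _) λ {s} → sat-alternates (s ∷ u ∷ []) v1 v0))

J : Query σ
J A = Σ (Ternary A) λ L → IsLocalOrder A L × expand A L ⊨ θ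

module _ (A : Structure σ) {L : Ternary A} (lo : IsLocalOrder A L) where

  θ⇒even : expand A L ⊨ θ → odd (atomCount A) ≡ false
  θ⇒even sat = let _ , _ , u , cov , s , alt = Equivalence.to (sat-θ A L) sat in Ranks.alternation⇒even A L lo u cov alt

  even⇒θ : HasAtomlessElement A → HasAtomJoins A → ∀ {u} → Covers A L u → odd (atomCount A) ≡ false → expand A L ⊨ θ
  even⇒θ atomless joins {u} cov even =
    Equivalence.from (sat-θ A L) (atomless , joins , u , cov , Ranks.even⇒alternation A L lo u cov atomless joins even)

θ-invariant : OInvariant θ
θ-invariant A L L' lo lo' sat =
  let atomless , joins , u , cov , _ = Equivalence.to (sat-θ A L) sat in
  even⇒θ A lo' atomless joins (adjacent⇒covers lo' (covers⇒adjacent lo cov)) (θ⇒even A lo sat)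

-- Powersets

pow2 : ℕ → ℕ
pow2 zero    = 1
pow2 (suc n) = pow2 n + pow2 n

decode : ∀ n → Fin (pow2 n) → Vec Bool n
decode zero    _ = []
decode (suc n) i = [ (false ∷_) ∘ decode n , (true ∷_) ∘ decode n ]′ (splitAt (pow2 n) i)

encode : ∀ {n} → Vec Bool n → Fin (pow2 n)
encode []                  = zero
encode {suc n} (false ∷ v) = encode v ↑ˡ pow2 n
encode {suc n} (true ∷ v)  = pow2 n ↑ʳ encode v

decode-↑ˡ : ∀ n (x : Fin (pow2 n)) → decode (suc n) (x ↑ˡ pow2 n) ≡ false ∷ decode n x
decode-↑ˡ n x rewrite splitAt-↑ˡ (pow2 n) x (pow2 n) = refl

decode-↑ʳ : ∀ n (x : Fin (pow2 n)) → decode (suc n) (pow2 n ↑ʳ x) ≡ true ∷ decode n x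
decode-↑ʳ n x rewrite splitAt-↑ʳ (pow2 n) (pow2 n) x = refl

decode-encode : ∀ {n} (v : Vec Bool n) → decode n (encode v) ≡ v
decode-encode []                  = refl
decode-encode {suc n} (false ∷ v) = trans (decode-↑ˡ n (encode v)) (cong (false ∷_) (decode-encode v))
decode-encode {suc n} (true ∷ v)  = trans (decode-↑ʳ n (encode v)) (cong (true ∷_) (decode-encode v))

encode-decode : ∀ n (i : Fin (pow2 n)) → encode (decode n i) ≡ i
encode-decode zero    zero = refl
encode-decode (suc n) i with splitAt (pow2 n) i in eq
... | inj₁ j = trans (cong (_↑ˡ pow2 n) (encode-decode n j)) (splitAt⁻¹-↑ˡ eq)
... | inj₂ j = trans (cong (pow2 n ↑ʳ_) (encode-decode n j)) (splitAt⁻¹-↑ʳ eq)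

decode-injective : ∀ n {i j : Fin (pow2 n)} → decode n i ≡ decode n j → i ≡ j
decode-injective n {i} {j} eq = trans (sym (encode-decode n i)) (trans (cong encode eq) (encode-decode n j))

_⊆ᵇ_ : ∀ {n} → Vec Bool n → Vec Bool n → Bool
[]      ⊆ᵇ []      = true
(x ∷ u) ⊆ᵇ (y ∷ v) = (not x ∨ y) ∧ (u ⊆ᵇ v)

⊆ᵇ⇒pointwise : ∀ {n} (u v : Vec Bool n) → u ⊆ᵇ v ≡ true → ∀ i → not (lookup u i) ∨ lookup v i ≡ true
⊆ᵇ⇒pointwise (x ∷ u) (y ∷ v) h zero    = ∧-conicalˡ (not x ∨ y) (u ⊆ᵇ v) h
⊆ᵇ⇒pointwise (x ∷ u) (y ∷ v) h (suc i) = ⊆ᵇ⇒pointwise u v (∧-conicalʳ (not x ∨ y) (u ⊆ᵇ v) h) i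

pointwise⇒⊆ᵇ : ∀ {n} (u v : Vec Bool n) → (∀ i → not (lookup u i) ∨ lookup v i ≡ true) → u ⊆ᵇ v ≡ true
pointwise⇒⊆ᵇ []      []      h = refl
pointwise⇒⊆ᵇ (x ∷ u) (y ∷ v) h rewrite h zero = pointwise⇒⊆ᵇ u v (h ∘ suc)

-- The element i of 𝒫 n is the subset of Fin n with characteristic vector decode n i.
𝒫 : ℕ → Structure σ
𝒫 n = record { size = pow2 n ; rel = λ { _ (x ∷ y ∷ []) → decode n x ⊆ᵇ decode n y } }

isEmpty : ∀ {n} → Vec Bool n → Bool
isEmpty []      = true
isEmpty (x ∷ v) = not x ∧ isEmpty v

isSingleton : ∀ {n} → Vec Bool n → Bool
isSingleton []          = false
isSingleton (false ∷ v) = isSingleton v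
isSingleton (true ∷ v)  = isEmpty v

isEmpty-replicate : ∀ n → isEmpty (replicate n false) ≡ true
isEmpty-replicate zero    = refl
isEmpty-replicate (suc n) = isEmpty-replicate n

isEmpty-unique : ∀ {n} {v w : Vec Bool n} → isEmpty v ≡ true → isEmpty w ≡ true → v ≡ w
isEmpty-unique {v = []}        {[]}        _ _ = refl
isEmpty-unique {v = false ∷ v} {false ∷ w} e e' = cong (false ∷_) (isEmpty-unique e e')

⊆ᵇ-refl : ∀ {n} (v : Vec Bool n) → v ⊆ᵇ v ≡ true
⊆ᵇ-refl []          = refl
⊆ᵇ-refl (true ∷ v)  = ⊆ᵇ-refl v
⊆ᵇ-refl (false ∷ v) = ⊆ᵇ-refl v

isEmpty-⊆ᵇ : ∀ {n} (v w : Vec Bool n) → isEmpty v ≡ true → v ⊆ᵇ w ≡ true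
isEmpty-⊆ᵇ []          []      _ = refl
isEmpty-⊆ᵇ (false ∷ v) (y ∷ w) e = isEmpty-⊆ᵇ v w e

⊆ᵇ-isEmpty : ∀ {n} (v w : Vec Bool n) → isEmpty w ≡ true → v ⊆ᵇ w ≡ true → isEmpty v ≡ true
⊆ᵇ-isEmpty []          []          _ _ = refl
⊆ᵇ-isEmpty (false ∷ v) (false ∷ w) e s = ⊆ᵇ-isEmpty v w e s

isSingleton⇒¬isEmpty : ∀ {n} (v : Vec Bool n) → isSingleton v ≡ true → ¬ isEmpty v ≡ true
isSingleton⇒¬isEmpty (false ∷ v) s e = isSingleton⇒¬isEmpty v s e

⊆ᵇ-isSingleton : ∀ {n} (v w : Vec Bool n) → isSingleton v ≡ true → w ⊆ᵇ v ≡ true → w ≡ v ⊎ isEmpty w ≡ true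
⊆ᵇ-isSingleton (false ∷ v) (false ∷ w) s w⊆v = map₁ (cong (false ∷_)) (⊆ᵇ-isSingleton v w s w⊆v)
⊆ᵇ-isSingleton (true ∷ v)  (true ∷ w)  s w⊆v = inj₁ (cong (true ∷_) (isEmpty-unique (⊆ᵇ-isEmpty w v s w⊆v) s))
⊆ᵇ-isSingleton (true ∷ v)  (false ∷ w) s w⊆v = inj₂ (⊆ᵇ-isEmpty w v s w⊆v)

minimal⇒isSingleton : ∀ {n} (v : Vec Bool n) → ¬ isEmpty v ≡ true →
  (∀ w → w ⊆ᵇ v ≡ true → w ≡ v ⊎ isEmpty w ≡ true) → isSingleton v ≡ true
minimal⇒isSingleton []          ¬e _   = ⊥-elim (¬e refl)
minimal⇒isSingleton (false ∷ v) ¬e min =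
  minimal⇒isSingleton v ¬e λ w w⊆v → map₁ ∷-injectiveʳ (min (false ∷ w) w⊆v)
minimal⇒isSingleton (true ∷ v)  ¬e min with min (false ∷ v) (⊆ᵇ-refl v)
... | inj₂ e = e

⊆ᵇ-∪ˡ : ∀ {n} (u v w : Vec Bool n) → u ⊆ᵇ v ≡ true → u ⊆ᵇ (v ∪ w) ≡ true
⊆ᵇ-∪ˡ []          []         []      _ = refl
⊆ᵇ-∪ˡ (false ∷ u) (y ∷ v)    (z ∷ w) s = ⊆ᵇ-∪ˡ u v w s
⊆ᵇ-∪ˡ (true ∷ u)  (true ∷ v) (z ∷ w) s = ⊆ᵇ-∪ˡ u v w s

⊆ᵇ-∪ʳ : ∀ {n} (v w : Vec Bool n) → w ⊆ᵇ (v ∪ w) ≡ true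
⊆ᵇ-∪ʳ []          []          = refl
⊆ᵇ-∪ʳ (y ∷ v)     (false ∷ w) = ⊆ᵇ-∪ʳ v w
⊆ᵇ-∪ʳ (true ∷ v)  (true ∷ w)  = ⊆ᵇ-∪ʳ v w
⊆ᵇ-∪ʳ (false ∷ v) (true ∷ w)  = ⊆ᵇ-∪ʳ v w

⊆ᵇ-∪-isEmpty : ∀ {n} (u v w : Vec Bool n) → isEmpty w ≡ true → u ⊆ᵇ (v ∪ w) ≡ true → u ⊆ᵇ v ≡ true
⊆ᵇ-∪-isEmpty []          []         []          _ _ = refl
⊆ᵇ-∪-isEmpty (false ∷ u) (y ∷ v)    (false ∷ w) e s = ⊆ᵇ-∪-isEmpty u v w e s
⊆ᵇ-∪-isEmpty (true ∷ u)  (true ∷ v) (false ∷ w) e s = ⊆ᵇ-∪-isEmpty u v w e s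

isSingleton-⊆ᵇ-∪ : ∀ {n} (u v w : Vec Bool n) → isSingleton u ≡ true → isSingleton w ≡ true →
  u ⊆ᵇ (v ∪ w) ≡ true → u ⊆ᵇ v ≡ true ⊎ u ≡ w
isSingleton-⊆ᵇ-∪ (false ∷ u) (y ∷ v)    (false ∷ w) su sw s = map₂ (cong (false ∷_)) (isSingleton-⊆ᵇ-∪ u v w su sw s)
isSingleton-⊆ᵇ-∪ (false ∷ u) (y ∷ v)    (true ∷ w)  su sw s = inj₁ (⊆ᵇ-∪-isEmpty u v w sw s)
isSingleton-⊆ᵇ-∪ (true ∷ u)  (true ∷ v) (false ∷ w) su sw s = inj₁ (isEmpty-⊆ᵇ u v su)
isSingleton-⊆ᵇ-∪ (true ∷ u)  (y ∷ v)    (true ∷ w)  su sw s = inj₂ (cong (true ∷_) (isEmpty-unique su sw))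

count-isEmpty : ∀ n → count (λ x → isEmpty (decode n x)) ≡ 1
count-isEmpty zero    = refl
count-isEmpty (suc n) = trans (count-++ (pow2 n) (pow2 n) _) (cong₂ _+_
  (trans (count-cong λ x → cong isEmpty (decode-↑ˡ n x)) (count-isEmpty n))
  (trans (count-cong λ x → cong isEmpty (decode-↑ʳ n x)) (count-false (pow2 n))))

count-isSingleton : ∀ n → count (λ x → isSingleton (decode n x)) ≡ n
count-isSingleton zero    = refl
count-isSingleton (suc n) = trans (count-++ (pow2 n) (pow2 n) _) (trans (cong₂ _+_
  (trans (count-cong λ x → cong isSingleton (decode-↑ˡ n x)) (count-isSingleton n))
  (trans (count-cong λ x → cong isSingleton (decode-↑ʳ n x)) (count-isEmpty n)))
  (+-comm n 1))

module _ (n : ℕ) where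

  ∅ : Fin (pow2 n)
  ∅ = encode (replicate n false)

  private
    P = 𝒫 n

    ⟦_⟧ : Fin (pow2 n) → Vec Bool n
    ⟦ a ⟧ = decode n a

    ⟦∅⟧-isEmpty : isEmpty ⟦ ∅ ⟧ ≡ true
    ⟦∅⟧-isEmpty = subst (λ v → isEmpty v ≡ true) (sym (decode-encode (replicate n false))) (isEmpty-replicate n)

  𝒫-bottom⇔isEmpty : ∀ a → IsBottom P a ⇔ isEmpty ⟦ a ⟧ ≡ true
  𝒫-bottom⇔isEmpty a = mk⇔
    (λ bottom → ⊆ᵇ-isEmpty ⟦ a ⟧ ⟦ ∅ ⟧ ⟦∅⟧-isEmpty (bottom ∅))
    (λ e c → isEmpty-⊆ᵇ ⟦ a ⟧ ⟦ c ⟧ e)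

  𝒫-atom⇔isSingleton : ∀ a → IsAtom P a ⇔ isSingleton ⟦ a ⟧ ≡ true
  𝒫-atom⇔isSingleton a = mk⇔
    (λ (¬bottom , below) → minimal⇒isSingleton ⟦ a ⟧ (¬bottom ∘ Equivalence.from (𝒫-bottom⇔isEmpty a)) λ w w⊆a →
       map-⊎ (λ w≡a → trans (sym (decode-encode w)) (cong (decode n) w≡a))
                    (subst (λ v → isEmpty v ≡ true) (decode-encode w) ∘ Equivalence.to (𝒫-bottom⇔isEmpty (encode w)))
                    (below (encode w) (subst (λ v → v ⊆ᵇ ⟦ a ⟧ ≡ true) (sym (decode-encode w)) w⊆a)))
    (λ s → (isSingleton⇒¬isEmpty ⟦ a ⟧ s ∘ Equivalence.to (𝒫-bottom⇔isEmpty a)) ,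
           λ b b⊑a → map-⊎ (decode-injective n) (Equivalence.from (𝒫-bottom⇔isEmpty b))
                                  (⊆ᵇ-isSingleton ⟦ a ⟧ ⟦ b ⟧ s b⊑a))

  𝒫-atomCount : atomCount P ≡ n
  𝒫-atomCount = trans
    (count-cong λ a → trans (does-⇔ (𝒫-atom⇔isSingleton a) (IsAtom? P a) (isSingleton ⟦ a ⟧ ≟ᵇ true)) (≟ᵇ-true _))
    (count-isSingleton n)

  𝒫-atomless : HasAtomlessElement P
  𝒫-atomless = ∅ , λ a at a⊑∅ →
    isSingleton⇒¬isEmpty ⟦ a ⟧ (Equivalence.to (𝒫-atom⇔isSingleton a) at) (⊆ᵇ-isEmpty ⟦ a ⟧ ⟦ ∅ ⟧ ⟦∅⟧-isEmpty a⊑∅)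

  𝒫-atomJoins : HasAtomJoins P
  𝒫-atomJoins x b atb = y , λ a ata → mk⇔ (to a ata) (from a)
    where
      y = encode (⟦ x ⟧ ∪ ⟦ b ⟧)
      below-y : ∀ a → _⊑_ P a y ⇔ ⟦ a ⟧ ⊆ᵇ (⟦ x ⟧ ∪ ⟦ b ⟧) ≡ true
      below-y a = mk⇔ (subst (λ v → ⟦ a ⟧ ⊆ᵇ v ≡ true) (decode-encode _))
                      (subst (λ v → ⟦ a ⟧ ⊆ᵇ v ≡ true) (sym (decode-encode _)))
      to : ∀ a → IsAtom P a → _⊑_ P a y → _⊑_ P a x ⊎ a ≡ b
      to a ata a⊑y = map₂ (decode-injective n)
        (isSingleton-⊆ᵇ-∪ ⟦ a ⟧ ⟦ x ⟧ ⟦ b ⟧ (Equivalence.to (𝒫-atom⇔isSingleton a) ata)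
                          (Equivalence.to (𝒫-atom⇔isSingleton b) atb) (Equivalence.to (below-y a) a⊑y))
      from : ∀ a → _⊑_ P a x ⊎ a ≡ b → _⊑_ P a y
      from a (inj₁ a⊑x) = Equivalence.from (below-y a) (⊆ᵇ-∪ˡ ⟦ a ⟧ ⟦ x ⟧ ⟦ b ⟧ a⊑x)
      from a (inj₂ refl) = Equivalence.from (below-y a) (⊆ᵇ-∪ʳ ⟦ x ⟧ ⟦ a ⟧)

  𝒫-∅-adjacent : ∀ a → IsAtom P a → Adjacent P ∅ a
  𝒫-∅-adjacent a at = Equivalence.from (adjacent⇔ P ∅ a)
    ( (λ ∅≡a → isSingleton⇒¬isEmpty ⟦ a ⟧ (Equivalence.to (𝒫-atom⇔isSingleton a) at)
                 (subst (λ c → isEmpty ⟦ c ⟧ ≡ true) ∅≡a ⟦∅⟧-isEmpty))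
    , inj₁ (isEmpty-⊆ᵇ ⟦ ∅ ⟧ ⟦ a ⟧ ⟦∅⟧-isEmpty))

J-𝒫 : ∀ n → J (𝒫 n) ⇔ odd n ≡ false
J-𝒫 n = mk⇔
  (λ (_ , lo , sat) → trans (cong odd (sym (𝒫-atomCount n))) (θ⇒even (𝒫 n) lo sat))
  (λ even → L , lo , even⇒θ (𝒫 n) lo (𝒫-atomless n) (𝒫-atomJoins n) {∅ n} (adjacent⇒covers lo (𝒫-∅-adjacent n))
                              (trans (cong odd (𝒫-atomCount n)) even))
  where
    L = adjacencyOrder (𝒫 n) (adjacent? (𝒫 n))
    lo = adjacencyOrder-isLocalOrder (𝒫 n) (adjacent? (𝒫 n))

-- Indistinguishability of large powersets

_≈[_]_ : ℕ → ℕ → ℕ → Set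
a ≈[ t ] b = a ≡ b ⊎ (t ≤ a × t ≤ b)

≈-sym : ∀ {a b t} → a ≈[ t ] b → b ≈[ t ] a
≈-sym (inj₁ a≡b)        = inj₁ (sym a≡b)
≈-sym (inj₂ (t≤a , t≤b)) = inj₂ (t≤b , t≤a)

t+t≤c⇒t≤c∸x : ∀ {t c x} → t + t ≤ c → x ≤ t → t ≤ c ∸ x
t+t≤c⇒t≤c∸x {t} 2t≤c x≤t = ≤-trans (≤-reflexive (sym (m+n∸n≡m t t))) (∸-mono 2t≤c x≤t)

≈-split : ∀ t p q c → (p + q) ≈[ t + t ] c →
  Σ ℕ λ p' → p' ≤ c × p ≈[ t ] p' × q ≈[ t ] (c ∸ p')
≈-split t p q .(p + q) (inj₁ refl) = p , m≤m+n p q , inj₁ refl , inj₁ (sym (m+n∸m≡n p q))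
≈-split t p q c (inj₂ (2t≤p+q , 2t≤c)) with t ≤? p | t ≤? q
... | no t≰p | no t≰q = ⊥-elim (<⇒≱ (+-mono-< (≰⇒> t≰p) (≰⇒> t≰q)) 2t≤p+q)
... | no t≰p | yes t≤q =
  p , ≤-trans (<⇒≤ (≰⇒> t≰p)) t≤c , inj₁ refl , inj₂ (t≤q , t+t≤c⇒t≤c∸x 2t≤c (<⇒≤ (≰⇒> t≰p)))
  where t≤c = ≤-trans (m≤m+n t t) 2t≤c
... | yes t≤p | no t≰q =
  c ∸ q , m∸n≤m c q , inj₂ (t≤p , t+t≤c⇒t≤c∸x 2t≤c (<⇒≤ (≰⇒> t≰q))) ,
  inj₁ (sym (m∸[m∸n]≡n (≤-trans (<⇒≤ (≰⇒> t≰q)) (≤-trans (m≤m+n t t) 2t≤c))))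
... | yes t≤p | yes t≤q =
  t , ≤-trans (m≤m+n t t) 2t≤c , inj₂ (t≤p , ≤-refl) , inj₂ (t≤q , t+t≤c⇒t≤c∸x 2t≤c ≤-refl)

pow2-pos : ∀ k → 0 < pow2 k
pow2-pos zero    = s≤s z≤n
pow2-pos (suc k) = ≤-trans (pow2-pos k) (m≤m+n _ _)

column : ∀ n {m} → Vec (Fin (pow2 n)) m → Fin n → Vec Bool m
column n ρ i = map (λ x → lookup (decode n x) i) ρ

column-lookup : ∀ n {m} (ρ : Vec (Fin (pow2 n)) m) i x → lookup (column n ρ i) x ≡ lookup (decode n (lookup ρ x)) i
column-lookup n ρ i x = lookup-map x (λ y → lookup (decode n y) i) ρ

cell : ∀ n {m} → Vec (Fin (pow2 n)) m → Vec Bool m → Fin n → Bool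
cell n ρ τ i = does (≡-dec _≟ᵇ_ (column n ρ i) τ)

-- Point i of the ground set has membership pattern column n ρ i in the tuple ρ. Two tuples are
-- k-similar if every pattern τ occurs equally often, or at least 2^k times, in both.
Similar : ∀ n n' {m} → ℕ → Vec (Fin (pow2 n)) m → Vec (Fin (pow2 n')) m → Set
Similar n n' k ρ ρ' = ∀ τ → count (cell n ρ τ) ≈[ pow2 k ] count (cell n' ρ' τ)

Columnwise : ∀ n {m} → (Vec Bool m → Bool) → Vec (Fin (pow2 n)) m → Set
Columnwise n Q ρ = ∀ i → Q (column n ρ i) ≡ true

columnwise-transfer : ∀ n n' {m} k (ρ : Vec (Fin (pow2 n)) m) (ρ' : Vec (Fin (pow2 n')) m) →
  Similar n n' k ρ ρ' → ∀ Q → Columnwise n Q ρ → Columnwise n' Q ρ'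
columnwise-transfer n n' k ρ ρ' sim Q h i = subst (λ τ → Q τ ≡ true) column-j≡τ (h j)
  where
    τ = column n' ρ' i
    τ-occurs : 0 < count (cell n ρ τ)
    τ-occurs with sim τ
    ... | inj₁ eq        = subst (0 <_) (sym eq) (count-pos (cell n' ρ' τ) i (dec-true (≡-dec _≟ᵇ_ τ τ) refl))
    ... | inj₂ (t≤c , _) = ≤-trans (pow2-pos k) t≤c
    j = proj₁ (count-witness (cell n ρ τ) τ-occurs)
    column-j≡τ = does-true (≡-dec _≟ᵇ_ _ τ) (proj₂ (count-witness (cell n ρ τ) τ-occurs))

⊑-columnwise : ∀ n {m} (ρ : Vec (Fin (pow2 n)) m) x y →
  (decode n (lookup ρ x) ⊆ᵇ decode n (lookup ρ y) ≡ true) ⇔ Columnwise n (λ τ → not (lookup τ x) ∨ lookup τ y) ρ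
⊑-columnwise n ρ x y = mk⇔
  (λ h i → subst₂ (λ a b → not a ∨ b ≡ true) (sym (column-lookup n ρ i x)) (sym (column-lookup n ρ i y))
             (⊆ᵇ⇒pointwise (decode n (lookup ρ x)) (decode n (lookup ρ y)) h i))
  (λ h → pointwise⇒⊆ᵇ (decode n (lookup ρ x)) (decode n (lookup ρ y)) λ i → subst₂ (λ a b → not a ∨ b ≡ true) (column-lookup n ρ i x) (column-lookup n ρ i y) (h i))

vec-ext : ∀ {A : Set} {n} {u v : Vec A n} → (∀ i → lookup u i ≡ lookup v i) → u ≡ v
vec-ext {u = u} {v} eq = trans (sym (tabulate∘lookup u)) (trans (tabulate-cong eq) (tabulate∘lookup v))

≡-columnwise : ∀ n {m} (ρ : Vec (Fin (pow2 n)) m) x y →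
  (lookup ρ x ≡ lookup ρ y) ⇔ Columnwise n (λ τ → does (lookup τ x ≟ᵇ lookup τ y)) ρ
≡-columnwise n ρ x y = mk⇔
  (λ eq i → dec-true (lookup (column n ρ i) x ≟ᵇ _)
              (trans (column-lookup n ρ i x) (trans (cong (λ z → lookup (decode n z) i) eq) (sym (column-lookup n ρ i y)))))
  (λ h → decode-injective n (vec-ext λ i →
           subst₂ _≡_ (column-lookup n ρ i x) (column-lookup n ρ i y) (does-true (_ ≟ᵇ _) (h i))))

-- Each class τ of ρ splits by membership in a; pick inside the class τ of ρ' a subset of a size
-- matching that split (≈-split), and let b be the union of these choices.
forth : ∀ n n' {m} k (ρ : Vec (Fin (pow2 n)) m) (ρ' : Vec (Fin (pow2 n')) m) →
  Similar n n' (suc k) ρ ρ' → ∀ a → Σ (Fin (pow2 n')) λ b → Similar n n' k (a ∷ ρ) (b ∷ ρ')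
forth n n' {m} k ρ ρ' sim a = b , similar
  where
    A : Fin n → Bool
    A i = lookup (decode n a) i
    split : ∀ τ → Σ ℕ λ p' → p' ≤ count (cell n' ρ' τ) ×
      count (λ i → A i ∧ cell n ρ τ i) ≈[ pow2 k ] p' ×
      count (λ i → not (A i) ∧ cell n ρ τ i) ≈[ pow2 k ] (count (cell n' ρ' τ) ∸ p')
    split τ = ≈-split (pow2 k) _ _ _ (subst (λ c → c ≈[ pow2 (suc k) ] _) (count-split (cell n ρ τ) A) (sim τ))
    p' : Vec Bool m → ℕ
    p' τ = proj₁ (split τ)
    choice : ∀ τ → Σ (Fin n' → Bool) λ q → count (λ i → q i ∧ cell n' ρ' τ i) ≡ p' τ
    choice τ = count-choose (cell n' ρ' τ) (p' τ) (proj₁ (proj₂ (split τ)))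
    B : Fin n' → Bool
    B i = proj₁ (choice (column n' ρ' i)) i
    b = encode (tabulate B)
    bit-b : ∀ i → lookup (decode n' b) i ≡ B i
    bit-b i = trans (cong (λ v → lookup v i) (decode-encode (tabulate B))) (lookup∘tabulate B i)
    inside : ∀ τ → count (λ i → B i ∧ cell n' ρ' τ i) ≡ p' τ
    inside τ = trans
      (count-cong λ i → ∧-cong-when (cell n' ρ' τ i) λ c → cong (λ τ' → proj₁ (choice τ') i) (does-true (≡-dec _≟ᵇ_ _ τ) c))
      (proj₂ (choice τ))
    outside : ∀ τ → count (λ i → not (B i) ∧ cell n' ρ' τ i) ≡ count (cell n' ρ' τ) ∸ p' τ
    outside τ = trans (sym (m+n∸m≡n (count (λ i → B i ∧ cell n' ρ' τ i)) _))
                      (cong₂ _∸_ (sym (count-split (cell n' ρ' τ) B)) (inside τ))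
    similar : Similar n n' k (a ∷ ρ) (b ∷ ρ')
    similar (true ∷ τ) = subst₂ (λ c c' → c ≈[ pow2 k ] c')
      (count-cong λ i → cong (_∧ cell n ρ τ i) (sym (≟ᵇ-true (A i))))
      (trans (sym (inside τ)) (count-cong λ i → cong (_∧ cell n' ρ' τ i) (sym (trans (≟ᵇ-true _) (bit-b i)))))
      (proj₁ (proj₂ (proj₂ (split τ))))
    similar (false ∷ τ) = subst₂ (λ c c' → c ≈[ pow2 k ] c')
      (count-cong λ i → cong (_∧ cell n ρ τ i) (sym (≟ᵇ-false (A i))))
      (trans (sym (outside τ)) (count-cong λ i → cong (_∧ cell n' ρ' τ i) (sym (trans (≟ᵇ-false _) (cong not (bit-b i))))))
      (proj₂ (proj₂ (proj₂ (split τ))))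

transfer : ∀ n n' {m} (φ : Formula σ m) k → qr φ ≤ k → (ρ : Vec (Fin (pow2 n)) m) (ρ' : Vec (Fin (pow2 n')) m) →
  Similar n n' k ρ ρ' → Sat (𝒫 n) ρ φ → Sat (𝒫 n') ρ' φ
transfer n n' (atom zero (x ∷ y ∷ [])) k _ ρ ρ' sim =
  Equivalence.from (⊑-columnwise n' ρ' x y) ∘
  columnwise-transfer n n' k ρ ρ' sim (λ τ → not (lookup τ x) ∨ lookup τ y) ∘ Equivalence.to (⊑-columnwise n ρ x y)
transfer n n' (equal x y) k _ ρ ρ' sim =
  Equivalence.from (≡-columnwise n' ρ' x y) ∘
  columnwise-transfer n n' k ρ ρ' sim (λ τ → does (lookup τ x ≟ᵇ lookup τ y)) ∘
  Equivalence.to (≡-columnwise n ρ x y)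
transfer n n' (neg φ) k r ρ ρ' sim ¬s s' = ¬s (transfer n' n φ k r ρ' ρ (≈-sym ∘ sim) s')
transfer n n' (conj φ ψ) k r ρ ρ' sim (s , t) =
  transfer n n' φ k (≤-trans (m≤m+n _ _) r) ρ ρ' sim s , transfer n n' ψ k (≤-trans (m≤n+m _ _) r) ρ ρ' sim t
transfer n n' (ex φ) (suc k) (s≤s r) ρ ρ' sim (a , s) =
  let b , sim' = forth n n' k ρ ρ' sim a in b , transfer n n' φ k r (a ∷ ρ) (b ∷ ρ') sim' s

𝒫-indistinguishable : ∀ (ψ : Sentence σ) → let n = pow2 (suc (qr ψ)) in 𝒫 n ⊨ ψ → 𝒫 (suc n) ⊨ ψ
𝒫-indistinguishable ψ = transfer _ _ ψ k ≤-refl [] [] similar-empty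
  where
    k = qr ψ
    similar-empty : Similar (pow2 (suc k)) (suc (pow2 (suc k))) k [] []
    similar-empty [] rewrite count-true (pow2 (suc k)) =
      inj₂ (m≤m+n (pow2 k) (pow2 k) , ≤-trans (m≤m+n (pow2 k) (pow2 k)) (m≤n+m _ 1))

theorem4p9 : Σ Vocabulary λ σ → Σ (Query σ) λ J →
    OInvariantElementary J × ¬ Elementary J
theorem4p9 = σ , J , (θ , θ-invariant , λ A → ⇔-id _) , not-elementary
  where
    not-elementary : ¬ Elementary J
    not-elementary (ψ , ψ-defines-J) = case trans (cong not (sym (odd-double (pow2 (qr ψ))))) odd-n+1 of λ ()
      where
        n = pow2 (suc (qr ψ))
        J-n : J (𝒫 n)
        J-n = Equivalence.from (J-𝒫 n) (odd-double (pow2 (qr ψ)))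
        odd-n+1 : odd (suc n) ≡ false
        odd-n+1 = Equivalence.to (J-𝒫 (suc n))
          (Equivalence.from (ψ-defines-J (𝒫 (suc n))) (𝒫-indistinguishable ψ (Equivalence.to (ψ-defines-J (𝒫 n)) J-n)))
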